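{- Every CNAT that has a long leaf has at least two interacting leaves.
   Context: A non-ambiguous tree (NAT) is a filling of a rectangular grid in which each cell is dotted or not, such that: the top-left cell is dotted (the root); every dotted cell other than the root has either a dotted cell above it in the same column or a dotted cell to its left in the same row, but not both; and every row and every column contains at least one dotted cell. Each non-root dot has a parent: the nearest dot above it in its column, or the nearest dot to its left in its row. A complete non-ambiguous tree (CNAT) is a NAT in which every dot either has both a dot below it in its column and a dot to its right in its row (an internal dot), or neither (a leaf). A leaf is short if its parent lies in a cell adjacent to it, and long otherwise. Rows are labelled from top to bottom and columns from left to right; $r(d)$ and $c(d)$ denote the row and column of a dot $d$. A leaf is a left leaf if it lies in the same column as its parent, and a right leaf if it lies in the same row as its parent. Two left leaves $l_1,l_2$ with parents $p_1,p_2$ are interacting if $r(p_1)<r(l_2)<r(l_1)$ or $r(p_2)<r(l_1)<r(l_2)$; two right leaves are interacting if $c(p_1)<c(l_2)<c(l_1)$ or $c(p_2)<c(l_1)<c(l_2)$. "Has two interacting leaves" means there is a pair of left leaves or a pair of right leaves that are interacting. -}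

module Defs where

open import Data.Nat using (ℕ; suc)
open import Data.Fin using (Fin; zero; toℕ; _<_)
open import Data.Bool using (Bool; true)
open import Data.Product using (Σ; ∃; ∃-syntax; _×_; _,_)
open import Data.Sum using (_⊎_)
open import Relation.Nullary using (¬_)
open import Relation.Binary.PropositionalEquality using (_≡_)

-- A filling of an m × n grid: rows indexed top-to-bottom, columns left-to-right,
-- both by Fin starting at 0.  'G i j ≡ true' means cell (row i, column j) is dotted.
Grid : ℕ → ℕ → Set
Grid m n = Fin m → Fin n → Bool

module _ {m n : ℕ} (G : Grid m n) where

  Dot : Fin m → Fin n → Set
  Dot i j = G i j ≡ true

  DotAbove : Fin m → Fin n → Set
  DotAbove i j = ∃[ i' ] (i' < i × Dot i' j)

  DotLeft : Fin m → Fin n → Set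
  DotLeft i j = ∃[ j' ] (j' < j × Dot i j')

  DotBelow : Fin m → Fin n → Set
  DotBelow i j = ∃[ i' ] (i < i' × Dot i' j)

  DotRight : Fin m → Fin n → Set
  DotRight i j = ∃[ j' ] (j < j' × Dot i j')

  IsRoot : Fin m → Fin n → Set
  IsRoot i j = toℕ i ≡ 0 × toℕ j ≡ 0

  _xor_ : Set → Set → Set
  A xor B = (A × ¬ B) ⊎ (¬ A × B)

  record IsNAT : Set where
    field
      rootDotted : ∃[ i ] ∃[ j ] (IsRoot i j × Dot i j)
      nonRoot    : ∀ i j → Dot i j → ¬ IsRoot i j → DotAbove i j xor DotLeft i j
      rowsHit    : ∀ i → ∃[ j ] Dot i j
      colsHit    : ∀ j → ∃[ i ] Dot i j

  Internal : Fin m → Fin n → Set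
  Internal i j = Dot i j × DotBelow i j × DotRight i j

  Leaf : Fin m → Fin n → Set
  Leaf i j = Dot i j × ¬ DotBelow i j × ¬ DotRight i j

  record IsCNAT : Set where
    field
      isNAT    : IsNAT
      complete : ∀ i j → Dot i j → Internal i j ⊎ Leaf i j

  ColParent : Fin m → Fin n → Fin m → Fin n → Set
  ColParent pi pj i j =
    pj ≡ j × pi < i × Dot pi j × (∀ k → pi < k → k < i → ¬ Dot k j)

  RowParent : Fin m → Fin n → Fin m → Fin n → Set
  RowParent pi pj i j =
    pi ≡ i × pj < j × Dot i pj × (∀ k → pj < k → k < j → ¬ Dot i k)

  Parent : Fin m → Fin n → Fin m → Fin n → Set
  Parent pi pj i j = ¬ IsRoot i j × (ColParent pi pj i j ⊎ RowParent pi pj i j)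

  Adjacent : Fin m → Fin n → Fin m → Fin n → Set
  Adjacent pi pj i j =
    (pj ≡ j × suc (toℕ pi) ≡ toℕ i) ⊎ (pi ≡ i × suc (toℕ pj) ≡ toℕ j)

  LongLeaf : Fin m → Fin n → Set
  LongLeaf i j = Leaf i j × ¬ IsRoot i j ×
    ∃[ pi ] ∃[ pj ] (Parent pi pj i j × ¬ Adjacent pi pj i j)

  LeftLeafWith : Fin m → Fin n → Fin m → Fin n → Set
  LeftLeafWith i j pi pj = Leaf i j × ¬ IsRoot i j × ColParent pi pj i j

  RightLeafWith : Fin m → Fin n → Fin m → Fin n → Set
  RightLeafWith i j pi pj = Leaf i j × ¬ IsRoot i j × RowParent pi pj i j

  InteractingLeft : Fin m → Fin n → Fin m → Fin n → Set
  InteractingLeft i1 j1 i2 j2 =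
    ∃[ p1i ] ∃[ p1j ] ∃[ p2i ] ∃[ p2j ]
      ( LeftLeafWith i1 j1 p1i p1j × LeftLeafWith i2 j2 p2i p2j
      × ((p1i < i2 × i2 < i1) ⊎ (p2i < i1 × i1 < i2)))

  InteractingRight : Fin m → Fin n → Fin m → Fin n → Set
  InteractingRight i1 j1 i2 j2 =
    ∃[ p1i ] ∃[ p1j ] ∃[ p2i ] ∃[ p2j ]
      ( RightLeafWith i1 j1 p1i p1j × RightLeafWith i2 j2 p2i p2j
      × ((p1j < j2 × j2 < j1) ⊎ (p2j < j1 × j1 < j2)))

  HasTwoInteractingLeaves : Set
  HasTwoInteractingLeaves =
    ∃[ i1 ] ∃[ j1 ] ∃[ i2 ] ∃[ j2 ]
      (InteractingLeft i1 j1 i2 j2 ⊎ InteractingRight i1 j1 i2 j2)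

  HasLongLeaf : Set
  HasLongLeaf = ∃[ i ] ∃[ j ] LongLeaf i j

-- Suppose no two leaves interact.  The parent p of a left leaf is internal, so
-- the row of p ends in a right leaf; likewise the column of the parent of a
-- right leaf ends in a left leaf.  Composing gives a self-map on left leaves,
-- and non-interaction makes it injective on rows: two leaves of the same kind
-- whose parents are nested as p₁ ≤ p₂ < l₁ must coincide.  A long leaf leaves a
-- gap between itself and its parent, and the line through the gap ends in a
-- left leaf outside the image, which is impossible in a finite grid.  Having
-- two interacting leaves is decidable, so the contradiction yields them.
module Submission where

open import Defs
open import Data.Nat using (ℕ)
import Data.Nat as ℕ
import Data.Nat.Properties as ℕₚ
open import Data.Fin using (Fin; zero; suc; toℕ; fromℕ<; _<_; _≤_)
open import Data.Fin.Properties
  using (any?; all?; <-cmp; <-irrefl; pigeonhole; toℕ<n; toℕ-fromℕ<)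
  renaming (_≟_ to _≟ᶠ_; _<?_ to _<ᶠ?_)
open import Data.Bool using (true)
open import Data.Bool.Properties using () renaming (_≟_ to _≟ᵇ_)
open import Data.Product using (∃; ∃-syntax; Σ-syntax; _×_; _,_; proj₁; proj₂)
open import Data.Sum using (_⊎_; inj₁; inj₂)
open import Data.Empty using (⊥-elim)
open import Function using (_∘_)
open import Relation.Nullary using (¬_; Dec; yes; no)
open import Relation.Nullary.Decidable.Core using (_×-dec_; _⊎-dec_; _→-dec_; ¬?)
open import Relation.Binary.PropositionalEquality using (_≡_; _≢_; refl; sym; subst)
open import Relation.Binary.Definitions using (tri<; tri≈; tri>)

greatest : ∀ {k} {P : Fin k → Set} → (∀ x → Dec (P x)) → ∃ P →
           ∃[ x ] (P x × ∀ y → x < y → ¬ P y)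
greatest {ℕ.suc k} P? (w , pw) with any? (P? ∘ suc)
... | yes later with greatest (P? ∘ suc) later
...   | x , px , max = suc x , px , λ { zero () ; (suc y) (ℕ.s≤s x<y) → max y x<y }
greatest {ℕ.suc k} P? (zero , pw)  | no none = zero , pw , λ { zero () ; (suc y) _ py → none (y , py) }
greatest {ℕ.suc k} P? (suc w , pw) | no none = ⊥-elim (none (w , pw))

≤-greatest : ∀ {k} {P : Fin k → Set} {x y : Fin k} → (∀ z → x < z → ¬ P z) → P y → y ≤ x
≤-greatest max py = ℕₚ.≮⇒≥ (λ x<y → max _ x<y py)

between : ∀ {k} {x y : Fin k} → x < y → ℕ.suc (toℕ x) ≢ toℕ y → ∃[ z ] (x < z × z < y)
between {k} {x} {y} x<y x+1≢y = z , x<z , z<y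
  where
    x+1<k : ℕ.suc (toℕ x) ℕ.< k
    x+1<k = ℕₚ.≤-<-trans x<y (toℕ<n y)
    z = fromℕ< x+1<k
    x<z : x < z
    x<z = subst (toℕ x ℕ.<_) (sym (toℕ-fromℕ< x+1<k)) (ℕₚ.n<1+n _)
    z<y : z < y
    z<y = subst (ℕ._< toℕ y) (sym (toℕ-fromℕ< x+1<k)) (ℕₚ.≤∧≢⇒< x<y x+1≢y)

-- The orbit of a point outside the image never repeats an index, so it would
-- give k + 1 distinct indices.
index-injective⇒index-surjective :
  ∀ {k} {P : Fin k → Set} (f : ∃ P → ∃ P) →
  (∀ x y → proj₁ (f x) ≡ proj₁ (f y) → proj₁ x ≡ proj₁ y) →
  (s : ∃ P) → ¬ (∀ x → proj₁ (f x) ≢ proj₁ s)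
index-injective⇒index-surjective {k} {P} f f-inj s missed =
  repetition (pigeonhole (ℕₚ.n<1+n k) (λ t → proj₁ (orbit (toℕ t))))
  where
    orbit : ℕ → ∃ P
    orbit ℕ.zero    = s
    orbit (ℕ.suc t) = f (orbit t)

    distinct : ∀ t u → t ℕ.< u → proj₁ (orbit t) ≢ proj₁ (orbit u)
    distinct ℕ.zero    (ℕ.suc u) _            eq = missed (orbit u) (sym eq)
    distinct (ℕ.suc t) (ℕ.suc u) (ℕ.s≤s t<u) eq = distinct t u t<u (f-inj (orbit t) (orbit u) eq)

    repetition : ¬ (∃[ t ] ∃[ u ] (t < u × proj₁ (orbit (toℕ t)) ≡ proj₁ (orbit (toℕ u))))
    repetition (t , u , t<u , same) = distinct (toℕ t) (toℕ u) t<u same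

module Decision {m n : ℕ} (G : Grid m n) where

  dot? : ∀ i j → Dec (Dot G i j)
  dot? i j = G i j ≟ᵇ true

  private
    leaf? : ∀ i j → Dec (Leaf G i j)
    leaf? i j = dot? i j
      ×-dec ¬? (any? λ k → (i <ᶠ? k) ×-dec dot? k j)
      ×-dec ¬? (any? λ k → (j <ᶠ? k) ×-dec dot? i k)

    root? : ∀ i j → Dec (IsRoot G i j)
    root? i j = (toℕ i ℕ.≟ 0) ×-dec (toℕ j ℕ.≟ 0)

    leftLeafWith? : ∀ i j pi pj → Dec (LeftLeafWith G i j pi pj)
    leftLeafWith? i j pi pj = leaf? i j ×-dec ¬? (root? i j)
      ×-dec (pj ≟ᶠ j) ×-dec (pi <ᶠ? i) ×-dec dot? pi j
      ×-dec all? (λ k → (pi <ᶠ? k) →-dec (k <ᶠ? i) →-dec ¬? (dot? k j))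

    rightLeafWith? : ∀ i j pi pj → Dec (RightLeafWith G i j pi pj)
    rightLeafWith? i j pi pj = leaf? i j ×-dec ¬? (root? i j)
      ×-dec (pi ≟ᶠ i) ×-dec (pj <ᶠ? j) ×-dec dot? i pj
      ×-dec all? (λ k → (pj <ᶠ? k) →-dec (k <ᶠ? j) →-dec ¬? (dot? i k))

    interactingLeft? : ∀ i₁ j₁ i₂ j₂ → Dec (InteractingLeft G i₁ j₁ i₂ j₂)
    interactingLeft? i₁ j₁ i₂ j₂ = any? λ p₁i → any? λ p₁j → any? λ p₂i → any? λ p₂j →
      leftLeafWith? i₁ j₁ p₁i p₁j ×-dec leftLeafWith? i₂ j₂ p₂i p₂j ×-dec
      ((p₁i <ᶠ? i₂) ×-dec (i₂ <ᶠ? i₁) ⊎-dec (p₂i <ᶠ? i₁) ×-dec (i₁ <ᶠ? i₂))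

    interactingRight? : ∀ i₁ j₁ i₂ j₂ → Dec (InteractingRight G i₁ j₁ i₂ j₂)
    interactingRight? i₁ j₁ i₂ j₂ = any? λ p₁i → any? λ p₁j → any? λ p₂i → any? λ p₂j →
      rightLeafWith? i₁ j₁ p₁i p₁j ×-dec rightLeafWith? i₂ j₂ p₂i p₂j ×-dec
      ((p₁j <ᶠ? j₂) ×-dec (j₂ <ᶠ? j₁) ⊎-dec (p₂j <ᶠ? j₁) ×-dec (j₁ <ᶠ? j₂))

  twoInteractingLeaves? : Dec (HasTwoInteractingLeaves G)
  twoInteractingLeaves? = any? λ i₁ → any? λ j₁ → any? λ i₂ → any? λ j₂ →
    interactingLeft? i₁ j₁ i₂ j₂ ⊎-dec interactingRight? i₁ j₁ i₂ j₂

module Lines {m n : ℕ} (G : Grid m n) where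
  open Decision G using (dot?)

  private variable
    i i′ p p′ k : Fin m
    j j′ q q′ c : Fin n

  colParent : DotAbove G i j → ∃[ p ] ColParent G p j i j
  colParent {i} {j} above with greatest (λ k → (k <ᶠ? i) ×-dec dot? k j) above
  ... | p , (p<i , dp) , max = p , refl , p<i , dp , λ k p<k k<i dk → max k p<k (k<i , dk)

  rowParent : DotLeft G i j → ∃[ q ] RowParent G i q i j
  rowParent {i} {j} left with greatest (λ k → (k <ᶠ? j) ×-dec dot? i k) left
  ... | q , (q<j , dq) , max = q , refl , q<j , dq , λ k q<k k<j dk → max k q<k (k<j , dk)

  colParent-unique : ColParent G p j i j → ColParent G p′ j i j → p ≡ p′
  colParent-unique {p} {p′ = p′} (_ , p<i , dp , gap) (_ , p′<i , dp′ , gap′) with <-cmp p p′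
  ... | tri< p<p′ _ _ = ⊥-elim (gap p′ p<p′ p′<i dp′)
  ... | tri≈ _ p≡p′ _ = p≡p′
  ... | tri> _ _ p′<p = ⊥-elim (gap′ p p′<p p<i dp)

  rowParent-unique : RowParent G i q i j → RowParent G i q′ i j → q ≡ q′
  rowParent-unique {q = q} {q′ = q′} (_ , q<j , dq , gap) (_ , q′<j , dq′ , gap′) with <-cmp q q′
  ... | tri< q<q′ _ _ = ⊥-elim (gap q′ q<q′ q′<j dq′)
  ... | tri≈ _ q≡q′ _ = q≡q′
  ... | tri> _ _ q′<q = ⊥-elim (gap′ q q′<q q<j dq)

  firstInRow-unique : Dot G i j → Dot G i j′ → ¬ DotLeft G i j → ¬ DotLeft G i j′ → j ≡ j′
  firstInRow-unique {j = j} {j′} d d′ first first′ with <-cmp j j′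
  ... | tri< j<j′ _ _ = ⊥-elim (first′ (j , j<j′ , d))
  ... | tri≈ _ j≡j′ _ = j≡j′
  ... | tri> _ _ j′<j = ⊥-elim (first (j′ , j′<j , d′))

  firstInCol-unique : Dot G i j → Dot G i′ j → ¬ DotAbove G i j → ¬ DotAbove G i′ j → i ≡ i′
  firstInCol-unique {i} {i′ = i′} d d′ first first′ with <-cmp i i′
  ... | tri< i<i′ _ _ = ⊥-elim (first′ (i , i<i′ , d))
  ... | tri≈ _ i≡i′ _ = i≡i′
  ... | tri> _ _ i′<i = ⊥-elim (first (i′ , i′<i , d′))

  ¬root-below : k < i → ¬ IsRoot G i j
  ¬root-below {k} k<i (i≡0 , _) = ℕₚ.n≮0 (subst (toℕ k ℕ.<_) i≡0 k<i)

  ¬root-right : c < j → ¬ IsRoot G i j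
  ¬root-right {c} c<j (_ , j≡0) = ℕₚ.n≮0 (subst (toℕ c ℕ.<_) j≡0 c<j)

module Complete {m n : ℕ} {G : Grid m n} (cnat : IsCNAT G) where
  open IsCNAT cnat
  open IsNAT isNAT
  open Decision G using (dot?)
  open Lines G

  private variable
    i p : Fin m
    j q : Fin n

  lastInRow : ∀ i → ∃[ j ] (Dot G i j × ∀ k → j < k → ¬ Dot G i k)
  lastInRow i = greatest (dot? i) (rowsHit i)

  lastInCol : ∀ j → ∃[ i ] (Dot G i j × ∀ k → i < k → ¬ Dot G k j)
  lastInCol j = greatest (λ i → dot? i j) (colsHit j)

  lastInRow-leaf : Dot G i j → (∀ k → j < k → ¬ Dot G i k) → Leaf G i j
  lastInRow-leaf {i} {j} d last with complete i j d
  ... | inj₁ (_ , _ , k , j<k , dk) = ⊥-elim (last k j<k dk)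
  ... | inj₂ leaf = leaf

  lastInCol-leaf : Dot G i j → (∀ k → i < k → ¬ Dot G k j) → Leaf G i j
  lastInCol-leaf {i} {j} d last with complete i j d
  ... | inj₁ (_ , (k , i<k , dk) , _) = ⊥-elim (last k i<k dk)
  ... | inj₂ leaf = leaf

  below⇒right : Dot G i j → DotBelow G i j → DotRight G i j
  below⇒right {i} {j} d below with complete i j d
  ... | inj₁ (_ , _ , right) = right
  ... | inj₂ (_ , ¬below , _) = ⊥-elim (¬below below)

  right⇒below : Dot G i j → DotRight G i j → DotBelow G i j
  right⇒below {i} {j} d right with complete i j d
  ... | inj₁ (_ , below , _) = below
  ... | inj₂ (_ , _ , ¬right) = ⊥-elim (¬right right)

  leftLeaf⇒¬left : LeftLeafWith G i j p j → ¬ DotLeft G i j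
  leftLeaf⇒¬left {i} {j} ((d , _) , ¬root , _ , p<i , dp , _) with nonRoot i j d ¬root
  ... | inj₁ (_ , ¬left) = ¬left
  ... | inj₂ (¬above , _) = ⊥-elim (¬above (_ , p<i , dp))

  rightLeaf⇒¬above : RightLeafWith G i j i q → ¬ DotAbove G i j
  rightLeaf⇒¬above {i} {j} ((d , _) , ¬root , _ , q<j , dq , _) with nonRoot i j d ¬root
  ... | inj₁ (_ , ¬left) = ⊥-elim (¬left (_ , q<j , dq))
  ... | inj₂ (¬above , _) = ¬above

  leaf-left⊎right : Leaf G i j → ¬ IsRoot G i j →
                    (∃[ p ] LeftLeafWith G i j p j) ⊎ (∃[ q ] RightLeafWith G i j i q)
  leaf-left⊎right {i} {j} leaf@(d , _) ¬root with nonRoot i j d ¬root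
  ... | inj₁ (above , _) = let p , cp = colParent above in inj₁ (p , leaf , ¬root , cp)
  ... | inj₂ (_ , left)  = let q , rp = rowParent left  in inj₂ (q , leaf , ¬root , rp)

  LeftLeafInRow : Fin m → Set
  LeftLeafInRow i = ∃[ j ] ∃[ p ] LeftLeafWith G i j p j

  LeftLeafInCol : Fin n → Set
  LeftLeafInCol j = ∃[ i ] ∃[ p ] LeftLeafWith G i j p j

  RightLeafInRow : Fin m → Set
  RightLeafInRow i = ∃[ j ] ∃[ q ] RightLeafWith G i j i q

  rowEnd-rightLeaf : Dot G i j → DotRight G i j → RightLeafInRow i
  rowEnd-rightLeaf {i} {j} dj (k , j<k , dk) =
    let c , dc , last = lastInRow i
        j<c = ℕₚ.<-≤-trans j<k (≤-greatest last dk)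
        q , rp = rowParent (j , j<c , dj)
    in c , q , lastInRow-leaf dc last , ¬root-right j<c , rp

  colEnd-leftLeaf : Dot G i j → DotBelow G i j → LeftLeafInCol j
  colEnd-leftLeaf {i} {j} di (k , i<k , dk) =
    let b , db , last = lastInCol j
        i<b = ℕₚ.<-≤-trans i<k (≤-greatest last dk)
        p , cp = colParent (i , i<b , di)
    in b , p , lastInCol-leaf db last , ¬root-below i<b , cp

  parentRow-rightLeaf : LeftLeafWith G i j p j → RightLeafInRow p
  parentRow-rightLeaf {i} ((di , _) , _ , _ , p<i , dp , _) =
    rowEnd-rightLeaf dp (below⇒right dp (i , p<i , di))

  parentCol-leftLeaf : RightLeafWith G i j i q → LeftLeafInCol q
  parentCol-leftLeaf {j = j} ((dj , _) , _ , _ , q<j , dq , _) =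
    colEnd-leftLeaf dq (right⇒below dq (j , q<j , dj))

  leftLeafInCol-unique : ∀ {j j′} (l : LeftLeafInCol j) (l′ : LeftLeafInCol j′) →
                         proj₁ l ≡ proj₁ l′ → j ≡ j′
  leftLeafInCol-unique (_ , _ , l@((d , _) , _)) (_ , _ , l′@((d′ , _) , _)) refl =
    firstInRow-unique d d′ (leftLeaf⇒¬left l) (leftLeaf⇒¬left l′)

module NoInteraction {m n : ℕ} {G : Grid m n} (cnat : IsCNAT G)
                     (none : ¬ HasTwoInteractingLeaves G) where
  open Lines G
  open Complete cnat

  private variable
    i₁ i₂ p₁ p₂ g : Fin m
    j₁ j₂ q₁ q₂ h : Fin n

  ¬interactingLeft : LeftLeafWith G i₁ j₁ p₁ j₁ → LeftLeafWith G i₂ j₂ p₂ j₂ →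
                     ¬ ((p₁ < i₂ × i₂ < i₁) ⊎ (p₂ < i₁ × i₁ < i₂))
  ¬interactingLeft l₁ l₂ nested = none (_ , _ , _ , _ , inj₁ (_ , _ , _ , _ , l₁ , l₂ , nested))

  ¬interactingRight : RightLeafWith G i₁ j₁ i₁ q₁ → RightLeafWith G i₂ j₂ i₂ q₂ →
                      ¬ ((q₁ < j₂ × j₂ < j₁) ⊎ (q₂ < j₁ × j₁ < j₂))
  ¬interactingRight r₁ r₂ nested = none (_ , _ , _ , _ , inj₂ (_ , _ , _ , _ , r₁ , r₂ , nested))

  leftLeaves-nested : LeftLeafWith G i₁ j₁ p₁ j₁ → LeftLeafWith G i₂ j₂ p₂ j₂ →
                      p₁ ≤ p₂ → p₂ < i₁ → i₁ ≡ i₂ × p₁ ≡ p₂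
  leftLeaves-nested {i₁} {i₂ = i₂} l₁@((d₁ , _) , _ , cp₁) l₂@((d₂ , _) , _ , cp₂@(_ , p₂<i₂ , _))
                    p₁≤p₂ p₂<i₁
    with <-cmp i₂ i₁
  ... | tri< i₂<i₁ _ _ = ⊥-elim (¬interactingLeft l₁ l₂ (inj₁ (ℕₚ.≤-<-trans p₁≤p₂ p₂<i₂ , i₂<i₁)))
  ... | tri> _ _ i₁<i₂ = ⊥-elim (¬interactingLeft l₁ l₂ (inj₂ (p₂<i₁ , i₁<i₂)))
  ... | tri≈ _ refl _ with firstInRow-unique d₁ d₂ (leftLeaf⇒¬left l₁) (leftLeaf⇒¬left l₂)
  ...   | refl = refl , colParent-unique cp₁ cp₂

  rightLeaves-nested : RightLeafWith G i₁ j₁ i₁ q₁ → RightLeafWith G i₂ j₂ i₂ q₂ →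
                       q₁ ≤ q₂ → q₂ < j₁ → i₁ ≡ i₂ × q₁ ≡ q₂
  rightLeaves-nested {j₁ = j₁} {j₂ = j₂} r₁@((d₁ , _) , _ , rp₁) r₂@((d₂ , _) , _ , rp₂@(_ , q₂<j₂ , _))
                     q₁≤q₂ q₂<j₁
    with <-cmp j₂ j₁
  ... | tri< j₂<j₁ _ _ = ⊥-elim (¬interactingRight r₁ r₂ (inj₁ (ℕₚ.≤-<-trans q₁≤q₂ q₂<j₂ , j₂<j₁)))
  ... | tri> _ _ j₁<j₂ = ⊥-elim (¬interactingRight r₁ r₂ (inj₂ (q₂<j₁ , j₁<j₂)))
  ... | tri≈ _ refl _ with firstInCol-unique d₁ d₂ (rightLeaf⇒¬above r₁) (rightLeaf⇒¬above r₂)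
  ...   | refl = refl , rowParent-unique rp₁ rp₂

  leftParent-not-between : LeftLeafWith G i₁ j₁ p₁ j₁ → p₁ < g → g < i₁ →
                           ¬ LeftLeafWith G i₂ j₂ g j₂
  leftParent-not-between l₁ p₁<g g<i₁ l₂ =
    <-irrefl (proj₂ (leftLeaves-nested l₁ l₂ (ℕₚ.<⇒≤ p₁<g) g<i₁)) p₁<g

  rightParent-not-between : RightLeafWith G i₁ j₁ i₁ q₁ → q₁ < h → h < j₁ →
                            ¬ RightLeafWith G i₂ j₂ i₂ h
  rightParent-not-between r₁ q₁<h h<j₁ r₂ =
    <-irrefl (proj₂ (rightLeaves-nested r₁ r₂ (ℕₚ.<⇒≤ q₁<h) h<j₁)) q₁<h

  parentCol-leftLeaf-injective :
    (r₁ : RightLeafWith G i₁ j₁ i₁ q₁) (r₂ : RightLeafWith G i₂ j₂ i₂ q₂) →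
    proj₁ (parentCol-leftLeaf r₁) ≡ proj₁ (parentCol-leftLeaf r₂) → i₁ ≡ i₂
  parentCol-leftLeaf-injective r₁@(_ , _ , _ , q₁<j₁ , _) r₂ same
    with leftLeafInCol-unique (parentCol-leftLeaf r₁) (parentCol-leftLeaf r₂) same
  ... | refl = proj₁ (rightLeaves-nested r₁ r₂ ℕₚ.≤-refl q₁<j₁)

  rightLeafOf : (l : LeftLeafWith G i₁ j₁ p₁ j₁) →
    RightLeafWith G p₁ (proj₁ (parentRow-rightLeaf l)) p₁ (proj₁ (proj₂ (parentRow-rightLeaf l)))
  rightLeafOf l = proj₂ (proj₂ (parentRow-rightLeaf l))

  step : ∃ LeftLeafInRow → ∃ LeftLeafInRow
  step (_ , _ , _ , l) = let b , p , l′ = parentCol-leftLeaf (rightLeafOf l) in b , _ , p , l′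

  step-injective : ∀ x y → proj₁ (step x) ≡ proj₁ (step y) → proj₁ x ≡ proj₁ y
  step-injective (_ , _ , _ , l₁@(_ , _ , _ , p₁<i₁ , _)) (_ , _ , _ , l₂) same
    with parentCol-leftLeaf-injective (rightLeafOf l₁) (rightLeafOf l₂) same
  ... | refl = proj₁ (leftLeaves-nested l₁ l₂ ℕₚ.≤-refl p₁<i₁)

  Missed : Set
  Missed = Σ[ s ∈ ∃ LeftLeafInRow ] ∀ x → proj₁ (step x) ≢ proj₁ s

  leftLongLeaf⇒missed : LeftLeafWith G i₁ j₁ p₁ j₁ → ℕ.suc (toℕ p₁) ≢ toℕ i₁ → Missed
  leftLongLeaf⇒missed l₀@(_ , _ , _ , p<i , _) not-adjacent with between p<i not-adjacent
  ... | g , p<g , g<i with lastInRow g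
  ... | _ , dc , last with leaf-left⊎right (lastInRow-leaf dc last) (¬root-below p<g)
  ... | inj₁ (_ , l) = ⊥-elim (¬interactingLeft l₀ l (inj₁ (p<g , g<i)))
  ... | inj₂ (_ , r) = let b , p , l = parentCol-leftLeaf r in (b , _ , p , l) , missed
    where
      missed : ∀ x → proj₁ (step x) ≢ proj₁ (parentCol-leftLeaf r)
      missed (_ , _ , _ , l) same with parentCol-leftLeaf-injective (rightLeafOf l) r same
      ... | refl = leftParent-not-between l₀ p<g g<i l

  rightLongLeaf⇒missed : RightLeafWith G i₁ j₁ i₁ q₁ → ℕ.suc (toℕ q₁) ≢ toℕ j₁ → Missed
  rightLongLeaf⇒missed r₀@(_ , _ , _ , q<j , _) not-adjacent with between q<j not-adjacent
  ... | h , q<h , h<j with lastInCol h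
  ... | b , db , last with leaf-left⊎right (lastInCol-leaf db last) (¬root-right q<h)
  ... | inj₂ (_ , r) = ⊥-elim (¬interactingRight r₀ r (inj₁ (q<h , h<j)))
  ... | inj₁ (p , l) = (b , h , p , l) , missed
    where
      missed : ∀ x → proj₁ (step x) ≢ b
      missed (_ , _ , _ , l′) same = rightParent-not-between r₀ q<h h<j
        (subst (RightLeafWith G _ _ _) parent≡h (rightLeafOf l′))
        where
          parent≡h = leftLeafInCol-unique (parentCol-leftLeaf (rightLeafOf l′)) (b , p , l) same

  longLeaf⇒missed : HasLongLeaf G → Missed
  longLeaf⇒missed (_ , _ , leaf , ¬root , _ , _ , (_ , inj₁ cp@(refl , _)) , not-adjacent) =
    leftLongLeaf⇒missed (leaf , ¬root , cp) (not-adjacent ∘ inj₁ ∘ (refl ,_))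
  longLeaf⇒missed (_ , _ , leaf , ¬root , _ , _ , (_ , inj₂ rp@(refl , _)) , not-adjacent) =
    rightLongLeaf⇒missed (leaf , ¬root , rp) (not-adjacent ∘ inj₂ ∘ (refl ,_))

  ¬longLeaf : ¬ HasLongLeaf G
  ¬longLeaf long = let s , missed = longLeaf⇒missed long in
    index-injective⇒index-surjective step step-injective s missed

lemma3 : (m n : ℕ) (G : Grid m n) → IsCNAT G → HasLongLeaf G → HasTwoInteractingLeaves G
lemma3 m n G cnat long with Decision.twoInteractingLeaves? G
... | yes two  = two
... | no none = ⊥-elim (NoInteraction.¬longLeaf cnat none long)
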